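{- Let $k_E$ be a finite field and $d\ge1$. Suppose $M=BDA$, where $M\in\mathrm{Mat}_d(k_E[[u]])$ is upper triangular with diagonal entries $c_1u^{t_1},\ldots,c_du^{t_d}$ with $c_i\in k_E[[u]]^\times$ and $t_i\ge0$ integers; $B\in\mathrm{GL}_d(k_E[[u]])$; $D=\mathrm{diag}(u^{r_1},\ldots,u^{r_d})$ with integers $0\le r_1\le\cdots\le r_d\le p$ (not necessarily distinct), where $p$ is the characteristic of $k_E$; and $A\in\mathrm{GL}_d(k_E[[u^p]])$. Then $\{t_1,\ldots,t_d\}=\{r_1,\ldots,r_d\}$ as sets. -}

module Defs where

open import Level using (Level; _⊔_)
open import Data.Nat as ℕ using (ℕ; zero; suc; _∸_; _≤_; _<_)
open import Data.Nat.Divisibility using (_∣_)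
import Data.Fin
import Relation.Nullary
open import Data.Nat.Primality using (Prime)
open import Data.Fin using (Fin; toℕ)
open import Data.Product using (Σ; ∃; _×_; _,_)
open import Relation.Nullary using (¬_)
open import Relation.Binary.PropositionalEquality using (_≡_)
open import Algebra.Bundles using (CommutativeRing)

record FiniteField (c ℓ : Level) : Set (Level.suc (c ⊔ ℓ)) where
  field
    commRing : CommutativeRing c ℓ
  open CommutativeRing commRing public
  field
    nontrivial : ¬ (1# ≈ 0#)
    inverse    : ∀ x → ¬ (x ≈ 0#) → Σ Carrier λ y → (x * y) ≈ 1#
    size       : ℕ
    enum       : Fin size → Carrier
    enum-onto  : ∀ x → Σ (Fin size) λ i → enum i ≈ x

module PowerSeries {c ℓ : Level} (F : FiniteField c ℓ) where
  open FiniteField F using (Carrier; _≈_; _+_; _*_; 0#; 1#)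

  natF : ℕ → Carrier
  natF zero    = 0#
  natF (suc n) = 1# + natF n

  IsCharacteristic : ℕ → Set ℓ
  IsCharacteristic p = Prime p × (natF p ≈ 0#)

  PS : Set c
  PS = ℕ → Carrier

  _≈ₚ_ : PS → PS → Set ℓ
  f ≈ₚ g = ∀ n → f n ≈ g n

  0ₚ : PS
  0ₚ _ = 0#

  1ₚ : PS
  1ₚ zero    = 1#
  1ₚ (suc _) = 0#

  _+ₚ_ : PS → PS → PS
  (f +ₚ g) n = f n + g n

  sumTo : ℕ → (ℕ → Carrier) → Carrier
  sumTo zero    h = h zero
  sumTo (suc n) h = sumTo n h + h (suc n)

  _*ₚ_ : PS → PS → PS
  (f *ₚ g) n = sumTo n λ i → f i * g (n ∸ i)

  u^ : ℕ → PS
  u^ t n with n ℕ.≟ t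
  ... | Relation.Nullary.yes _ = 1#
  ... | Relation.Nullary.no  _ = 0#

  IsUnitₚ : PS → Set (c ⊔ ℓ)
  IsUnitₚ f = Σ PS λ g → (f *ₚ g) ≈ₚ 1ₚ

  In-k[[u^p]] : ℕ → PS → Set ℓ
  In-k[[u^p]] p f = ∀ n → ¬ (p ∣ n) → f n ≈ 0#

  Mat : ℕ → Set c
  Mat d = Fin d → Fin d → PS

  _≈ₘ_ : ∀ {d} → Mat d → Mat d → Set ℓ
  M ≈ₘ N = ∀ i j → M i j ≈ₚ N i j

  sumFin : ∀ {d} → (Fin d → PS) → PS
  sumFin {zero}  h = 0ₚ
  sumFin {suc d} h = h Fin.zero +ₚ sumFin {d} (λ j → h (Fin.suc j))
    where import Data.Fin as Fin

  _*ₘ_ : ∀ {d} → Mat d → Mat d → Mat d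
  (M *ₘ N) i k = sumFin λ j → M i j *ₚ N j k

  Iₘ : ∀ {d} → Mat d
  Iₘ i j with i Data.Fin.≟ j
  ... | Relation.Nullary.yes _ = 1ₚ
  ... | Relation.Nullary.no  _ = 0ₚ

  IsGL : ∀ {d} → Mat d → Set (c ⊔ ℓ)
  IsGL M = Σ (Mat _) λ N → ((M *ₘ N) ≈ₘ Iₘ) × ((N *ₘ M) ≈ₘ Iₘ)

  IsGL-u^p : ℕ → ∀ {d} → Mat d → Set (c ⊔ ℓ)
  IsGL-u^p p M = (∀ i j → In-k[[u^p]] p (M i j))
               × Σ (Mat _) λ N → (∀ i j → In-k[[u^p]] p (N i j))
                               × ((M *ₘ N) ≈ₘ Iₘ) × ((N *ₘ M) ≈ₘ Iₘ)

  diagU : ∀ {d} → (Fin d → ℕ) → Mat d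
  diagU r i j with i Data.Fin.≟ j
  ... | Relation.Nullary.yes _ = u^ (r i)
  ... | Relation.Nullary.no  _ = 0ₚ

  UpperTriangularWithDiag : ∀ {d} → Mat d → (Fin d → PS) → (Fin d → ℕ) → Set ℓ
  UpperTriangularWithDiag M cs t =
    (∀ i j → toℕ j < toℕ i → M i j ≈ₚ 0ₚ) × (∀ i → M i i ≈ₚ (cs i *ₚ u^ (t i)))

-- For every s the level sets {j | s ≤ r_j} and {i | s ≤ t_i} have
-- the same size; then t and r take the same values (LevelSets.values-transfer).
-- Both inequalities are rank bounds over k (RankBound.rank-bound: a matrix that
-- is injective on the vectors supported on p, read off in the rows q, forces
-- ∣ p ∣ ≤ ∣ q ∣):
--  * #{r ≥ s} ≤ #{t ≥ s}: the constant term N₀ of A⁻¹ is injective in this sense,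
--    as one sees by reducing M · N₀ ξ modulo u^s (Factorisation.injective-I);
--  * #{r ≤ m} ≤ #{t ≤ m}: dually for row vectors, using X = A⁻¹ D′ B⁻¹ with
--    D′ = diag(u^{p - r_j}); M X = u^p, so X is upper triangular as well
--    (Factorisation.injective-II).
-- In both cases the vanishing comes from a pivot argument for triangular matrices
-- over k[[u]] (Triangular).
module Submission where

open import Level using (Level; _⊔_)
open import Function using (_∘_)
open import Data.Empty using (⊥-elim)
open import Data.Product using (Σ; _×_; _,_; proj₁; proj₂)
open import Data.Sum using (_⊎_; inj₁; inj₂)
open import Data.Nat as ℕ using (ℕ; zero; suc; _∸_; _≤_; _<_; z≤n; s≤s) renaming (_+_ to _+ℕ_)
import Data.Nat.Properties as ℕP
open import Data.Nat.Divisibility using (∣⇒≤)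
open import Data.Fin as Fin using (Fin; toℕ)
import Data.Fin.Properties as FinP
open import Data.Fin.Induction using (<-wellFounded; >-wellFounded)
open import Induction.WellFounded using (module All)
open import Relation.Binary.PropositionalEquality as ≡ using (_≡_; _≢_)
open import Relation.Binary.Bundles using (Setoid)
open import Relation.Binary.Definitions using (tri<; tri≈; tri>)
import Relation.Binary.Reasoning.Setoid as SetoidReasoning
open import Relation.Nullary using (yes; no; ¬_; Dec; ¬?; _×-dec_)
open import Relation.Nullary.Decidable using (decidable-stable; ¬¬-excluded-middle)
open import Relation.Nullary.Negation using (¬¬-map)
open import Algebra.Bundles using (CommutativeRing)

open import Defs

module SeriesRing {c ℓ : Level} (F : FiniteField c ℓ) where
  open FiniteField F hiding (zero)
  open PowerSeries F
  open SetoidReasoning setoid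

  sumTo-cong : ∀ n {h g : ℕ → Carrier} → (∀ i → i ≤ n → h i ≈ g i) → sumTo n h ≈ sumTo n g
  sumTo-cong zero    h≈g = h≈g 0 z≤n
  sumTo-cong (suc n) h≈g = +-cong (sumTo-cong n (λ i i≤n → h≈g i (ℕP.m≤n⇒m≤1+n i≤n))) (h≈g (suc n) ℕP.≤-refl)

  sumTo-+ : ∀ n (h g : ℕ → Carrier) → sumTo n (λ i → h i + g i) ≈ sumTo n h + sumTo n g
  sumTo-+ zero    h g = refl
  sumTo-+ (suc n) h g = begin
    sumTo n (λ i → h i + g i) + (h (suc n) + g (suc n)) ≈⟨ +-congʳ (sumTo-+ n h g) ⟩
    (sumTo n h + sumTo n g) + (h (suc n) + g (suc n))   ≈⟨ +-assoc _ _ _ ⟩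
    sumTo n h + (sumTo n g + (h (suc n) + g (suc n)))   ≈⟨ +-congˡ (x+[y+z]≈y+[x+z] _ _ _) ⟩
    sumTo n h + (h (suc n) + (sumTo n g + g (suc n)))   ≈⟨ +-assoc _ _ _ ⟨
    (sumTo n h + h (suc n)) + (sumTo n g + g (suc n))   ∎
    where
    x+[y+z]≈y+[x+z] : ∀ x y z → x + (y + z) ≈ y + (x + z)
    x+[y+z]≈y+[x+z] x y z = trans (sym (+-assoc x y z)) (trans (+-congʳ (+-comm x y)) (+-assoc y x z))

  sumTo-*ˡ : ∀ n x (h : ℕ → Carrier) → x * sumTo n h ≈ sumTo n (λ i → x * h i)
  sumTo-*ˡ zero    x h = refl
  sumTo-*ˡ (suc n) x h = trans (distribˡ _ _ _) (+-congʳ (sumTo-*ˡ n x h))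

  sumTo-*ʳ : ∀ n x (h : ℕ → Carrier) → sumTo n h * x ≈ sumTo n (λ i → h i * x)
  sumTo-*ʳ zero    x h = refl
  sumTo-*ʳ (suc n) x h = trans (distribʳ _ _ _) (+-congʳ (sumTo-*ʳ n x h))

  sumTo-zero : ∀ n (h : ℕ → Carrier) → (∀ i → i ≤ n → h i ≈ 0#) → sumTo n h ≈ 0#
  sumTo-zero zero    h h≈0 = h≈0 0 z≤n
  sumTo-zero (suc n) h h≈0 =
    trans (+-cong (sumTo-zero n h (λ i i≤n → h≈0 i (ℕP.m≤n⇒m≤1+n i≤n))) (h≈0 (suc n) ℕP.≤-refl)) (+-identityˡ _)

  sumTo-single : ∀ n k (h : ℕ → Carrier) → k ≤ n → (∀ i → i ≤ n → i ≢ k → h i ≈ 0#) → sumTo n h ≈ h k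
  sumTo-single zero    .zero h z≤n _ = refl
  sumTo-single (suc n) k h k≤1+n h≈0 with k ℕ.≟ suc n
  ... | yes ≡.refl = trans (+-congʳ (sumTo-zero n h (λ i i≤n → h≈0 i (ℕP.m≤n⇒m≤1+n i≤n) (ℕP.<⇒≢ (s≤s i≤n)))))
                           (+-identityˡ _)
  ... | no k≢1+n   = trans (+-cong (sumTo-single n k h (ℕP.≤-pred (ℕP.≤∧≢⇒< k≤1+n k≢1+n))
                                                 (λ i i≤n → h≈0 i (ℕP.m≤n⇒m≤1+n i≤n)))
                                   (h≈0 (suc n) ℕP.≤-refl (k≢1+n ∘ ≡.sym)))
                           (+-identityʳ _)

  sumTo-unshift : ∀ n (h : ℕ → Carrier) → sumTo (suc n) h ≈ h 0 + sumTo n (λ i → h (suc i))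
  sumTo-unshift zero    h = refl
  sumTo-unshift (suc n) h = trans (+-congʳ (sumTo-unshift n h)) (+-assoc _ _ _)

  sumTo-reverse : ∀ n (h : ℕ → Carrier) → sumTo n h ≈ sumTo n (λ i → h (n ∸ i))
  sumTo-reverse zero    h = refl
  sumTo-reverse (suc n) h = begin
    sumTo n h + h (suc n)                    ≈⟨ +-comm _ _ ⟩
    h (suc n) + sumTo n h                    ≈⟨ +-congˡ (sumTo-reverse n h) ⟩
    h (suc n) + sumTo n (λ i → h (n ∸ i))    ≈⟨ sumTo-unshift n (λ i → h (suc n ∸ i)) ⟨
    sumTo (suc n) (λ i → h (suc n ∸ i))      ∎

  sumTo-triangle : ∀ n (G : ℕ → ℕ → Carrier) →
    sumTo n (λ i → sumTo i (G i)) ≈ sumTo n (λ j → sumTo (n ∸ j) (λ l → G (j +ℕ l) j))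
  sumTo-triangle zero    G = refl
  sumTo-triangle (suc n) G = begin
    sumTo n (λ i → sumTo i (G i)) + (sumTo n (G (suc n)) + G (suc n) (suc n))
      ≈⟨ +-assoc _ _ _ ⟨
    (sumTo n (λ i → sumTo i (G i)) + sumTo n (G (suc n))) + G (suc n) (suc n)
      ≈⟨ +-congʳ (+-congʳ (sumTo-triangle n G)) ⟩
    (sumTo n (λ j → column n j) + sumTo n (G (suc n))) + G (suc n) (suc n)
      ≈⟨ +-congʳ (sumTo-+ n _ _) ⟨
    sumTo n (λ j → column n j + G (suc n) j) + G (suc n) (suc n)
      ≈⟨ +-cong (sumTo-cong n extend) lastColumn ⟩
    sumTo n (λ j → column (suc n) j) + column (suc n) (suc n) ∎
    where
    column : ℕ → ℕ → Carrier
    column m j = sumTo (m ∸ j) (λ l → G (j +ℕ l) j)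
    extend : ∀ j → j ≤ n → column n j + G (suc n) j ≈ column (suc n) j
    extend j j≤n rewrite ℕP.+-∸-assoc 1 j≤n =
      +-congˡ (reflexive (≡.cong (λ k → G k j)
        (≡.trans (≡.sym (ℕP.m+[n∸m]≡n (ℕP.m≤n⇒m≤1+n j≤n))) (≡.cong (j +ℕ_) (ℕP.+-∸-assoc 1 j≤n)))))
    lastColumn : G (suc n) (suc n) ≈ column (suc n) (suc n)
    lastColumn rewrite ℕP.n∸n≡0 n | ℕP.+-identityʳ n = refl

  *ₚ-cong : ∀ {f f′ g g′} → f ≈ₚ f′ → g ≈ₚ g′ → (f *ₚ g) ≈ₚ (f′ *ₚ g′)
  *ₚ-cong f≈f′ g≈g′ n = sumTo-cong n (λ i _ → *-cong (f≈f′ i) (g≈g′ (n ∸ i)))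

  *ₚ-comm : ∀ f g → (f *ₚ g) ≈ₚ (g *ₚ f)
  *ₚ-comm f g n = begin
    sumTo n (λ i → f i * g (n ∸ i))               ≈⟨ sumTo-reverse n _ ⟩
    sumTo n (λ i → f (n ∸ i) * g (n ∸ (n ∸ i)))   ≈⟨ sumTo-cong n swap ⟩
    sumTo n (λ i → g i * f (n ∸ i))               ∎
    where
    swap : ∀ i → i ≤ n → f (n ∸ i) * g (n ∸ (n ∸ i)) ≈ g i * f (n ∸ i)
    swap i i≤n rewrite ℕP.m∸[m∸n]≡n i≤n = *-comm _ _

  *ₚ-assoc : ∀ f g h → ((f *ₚ g) *ₚ h) ≈ₚ (f *ₚ (g *ₚ h))
  *ₚ-assoc f g h n = begin
    sumTo n (λ i → sumTo i (λ j → f j * g (i ∸ j)) * h (n ∸ i))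
      ≈⟨ sumTo-cong n (λ i _ → sumTo-*ʳ i _ _) ⟩
    sumTo n (λ i → sumTo i (λ j → (f j * g (i ∸ j)) * h (n ∸ i)))
      ≈⟨ sumTo-triangle n _ ⟩
    sumTo n (λ j → sumTo (n ∸ j) (λ l → (f j * g ((j +ℕ l) ∸ j)) * h (n ∸ (j +ℕ l))))
      ≈⟨ sumTo-cong n (λ j _ → sumTo-cong (n ∸ j) (λ l _ → reindex j l)) ⟩
    sumTo n (λ j → sumTo (n ∸ j) (λ l → f j * (g l * h ((n ∸ j) ∸ l))))
      ≈⟨ sumTo-cong n (λ j _ → sumTo-*ˡ (n ∸ j) _ _) ⟨
    sumTo n (λ j → f j * sumTo (n ∸ j) (λ l → g l * h ((n ∸ j) ∸ l))) ∎
    where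
    reindex : ∀ j l → (f j * g ((j +ℕ l) ∸ j)) * h (n ∸ (j +ℕ l)) ≈ f j * (g l * h ((n ∸ j) ∸ l))
    reindex j l rewrite ℕP.m+n∸m≡n j l | ℕP.∸-+-assoc n j l = *-assoc _ _ _

  *ₚ-identityˡ : ∀ f → (1ₚ *ₚ f) ≈ₚ f
  *ₚ-identityˡ f n = trans (sumTo-single n 0 _ z≤n onlyZero) (*-identityˡ _)
    where
    onlyZero : ∀ i → i ≤ n → i ≢ 0 → 1ₚ i * f (n ∸ i) ≈ 0#
    onlyZero zero    _ 0≢0 = ⊥-elim (0≢0 ≡.refl)
    onlyZero (suc i) _ _   = zeroˡ _

  *ₚ-distribˡ : ∀ f g h → (f *ₚ (g +ₚ h)) ≈ₚ ((f *ₚ g) +ₚ (f *ₚ h))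
  *ₚ-distribˡ f g h n = trans (sumTo-cong n (λ i _ → distribˡ _ _ _)) (sumTo-+ n _ _)

  -ₚ_ : PS → PS
  (-ₚ f) n = - f n

  psRing : CommutativeRing c ℓ
  psRing = record
    { Carrier = PS ; _≈_ = _≈ₚ_ ; _+_ = _+ₚ_ ; _*_ = _*ₚ_ ; -_ = -ₚ_ ; 0# = 0ₚ ; 1# = 1ₚ
    ; isCommutativeRing = record
      { isRing = record
        { +-isAbelianGroup = record
          { isGroup = record
            { isMonoid = record
              { isSemigroup = record
                { isMagma = record
                  { isEquivalence = record
                    { refl = λ _ → refl ; sym = λ e n → sym (e n) ; trans = λ e e′ n → trans (e n) (e′ n) }
                  ; ∙-cong = λ e e′ n → +-cong (e n) (e′ n) }
                ; assoc = λ f g h n → +-assoc (f n) (g n) (h n) }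
              ; identity = (λ f n → +-identityˡ (f n)) , (λ f n → +-identityʳ (f n)) }
            ; inverse = (λ f n → -‿inverseˡ (f n)) , (λ f n → -‿inverseʳ (f n))
            ; ⁻¹-cong = λ e n → -‿cong (e n) }
          ; comm = λ f g n → +-comm (f n) (g n) }
        ; *-cong = *ₚ-cong
        ; *-assoc = *ₚ-assoc
        ; *-identity = *ₚ-identityˡ , (λ f n → trans (*ₚ-comm f 1ₚ n) (*ₚ-identityˡ f n))
        ; distrib = *ₚ-distribˡ
                  , (λ h f g n → trans (*ₚ-comm (f +ₚ g) h n)
                                  (trans (*ₚ-distribˡ h f g n) (+-cong (*ₚ-comm h f n) (*ₚ-comm h g n))))
        }
      ; *-comm = *ₚ-comm
      }
    }

module Matrices {c ℓ : Level} (R : CommutativeRing c ℓ) where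
  open CommutativeRing R
  open import Algebra.Properties.Semiring.Sum semiring public
    using (sum; sum-cong-≋; ∑-distrib-+; ∑-comm; *-distribˡ-sum; *-distribʳ-sum)
  open import Algebra.Properties.Ring ring using (-‿distribˡ-*; -‿distribʳ-*)
  open SetoidReasoning setoid

  Matrix : ℕ → Set c
  Matrix d = Fin d → Fin d → Carrier

  Vector : ℕ → Set c
  Vector d = Fin d → Carrier

  _≈ᵐ_ : ∀ {d} → Matrix d → Matrix d → Set ℓ
  M ≈ᵐ N = ∀ i j → M i j ≈ N i j

  _≈ᵛ_ : ∀ {d} → Vector d → Vector d → Set ℓ
  v ≈ᵛ w = ∀ i → v i ≈ w i

  infix  4 _≈ᵐ_ _≈ᵛ_
  infixl 7 _⊛_ _◁_
  infixr 7 _▷_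

  _⊛_ : ∀ {d} → Matrix d → Matrix d → Matrix d
  (M ⊛ N) i k = sum λ j → M i j * N j k

  _▷_ : ∀ {d} → Matrix d → Vector d → Vector d
  (M ▷ v) i = sum λ j → M i j * v j

  _◁_ : ∀ {d} → Vector d → Matrix d → Vector d
  (w ◁ M) k = sum λ i → w i * M i k

  matrixSetoid : ℕ → Setoid c ℓ
  matrixSetoid d = record
    { Carrier = Matrix d ; _≈_ = _≈ᵐ_
    ; isEquivalence = record
      { refl = λ _ _ → refl ; sym = λ e i j → sym (e i j) ; trans = λ e e′ i j → trans (e i j) (e′ i j) } }

  sum-zero : ∀ {d} (f : Vector d) → (∀ j → f j ≈ 0#) → sum f ≈ 0#
  sum-zero {zero}  f f≈0 = refl
  sum-zero {suc d} f f≈0 = trans (+-cong (f≈0 Fin.zero) (sum-zero (f ∘ Fin.suc) (f≈0 ∘ Fin.suc))) (+-identityˡ _)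

  sum-single : ∀ {d} (f : Vector d) k → (∀ j → j ≢ k → f j ≈ 0#) → sum f ≈ f k
  sum-single f Fin.zero    f≈0 = trans (+-congˡ (sum-zero _ (λ j → f≈0 (Fin.suc j) λ ()))) (+-identityʳ _)
  sum-single f (Fin.suc k) f≈0 =
    trans (+-congʳ (f≈0 Fin.zero λ ()))
          (trans (+-identityˡ _) (sum-single (f ∘ Fin.suc) k (λ j j≢k → f≈0 (Fin.suc j) (j≢k ∘ FinP.suc-injective))))

  δ : ∀ {d} → Matrix d
  δ i j with i Fin.≟ j
  ... | yes _ = 1#
  ... | no  _ = 0#

  δ-diag : ∀ {d} (i : Fin d) → δ i i ≈ 1#
  δ-diag i with i Fin.≟ i
  ... | yes _   = refl
  ... | no  i≢i = ⊥-elim (i≢i ≡.refl)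

  δ-off : ∀ {d} {i j : Fin d} → i ≢ j → δ i j ≈ 0#
  δ-off {i = i} {j} i≢j with i Fin.≟ j
  ... | yes i≡j = ⊥-elim (i≢j i≡j)
  ... | no  _   = refl

  ⊛-δ : ∀ {d} (G : Matrix d) i k → (G ⊛ δ) i k ≈ G i k
  ⊛-δ G i k = trans (sum-single _ k offDiag) (trans (*-congˡ (δ-diag k)) (*-identityʳ _))
    where
    offDiag : ∀ j → j ≢ k → G i j * δ j k ≈ 0#
    offDiag j j≢k = trans (*-congˡ (δ-off j≢k)) (zeroʳ _)

  ⊛-assoc : ∀ {d} (L M N : Matrix d) → (L ⊛ M) ⊛ N ≈ᵐ L ⊛ (M ⊛ N)
  ⊛-assoc {d} L M N i l = begin
    sum (λ k → sum (λ j → L i j * M j k) * N k l)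
      ≈⟨ sum-cong-≋ {d} (λ k → *-distribʳ-sum {d} _ _) ⟩
    sum (λ k → sum (λ j → L i j * M j k * N k l))
      ≈⟨ ∑-comm {d} {d} _ ⟩
    sum (λ j → sum (λ k → L i j * M j k * N k l))
      ≈⟨ sum-cong-≋ {d} (λ j → sum-cong-≋ {d} (λ k → *-assoc _ _ _)) ⟩
    sum (λ j → sum (λ k → L i j * (M j k * N k l)))
      ≈⟨ sum-cong-≋ {d} (λ j → *-distribˡ-sum {d} _ _) ⟨
    sum (λ j → L i j * sum (λ k → M j k * N k l)) ∎

  ▷-assoc : ∀ {d} (M N : Matrix d) v → (M ⊛ N) ▷ v ≈ᵛ M ▷ N ▷ v
  ▷-assoc M N v i = ⊛-assoc M N (λ k _ → v k) i i

  ◁-assoc : ∀ {d} w (M N : Matrix d) → w ◁ (M ⊛ N) ≈ᵛ w ◁ M ◁ N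
  ◁-assoc w M N k = sym (⊛-assoc (λ _ i → w i) M N k k)

  ⊛-cong : ∀ {d} {M M′ N N′ : Matrix d} → M ≈ᵐ M′ → N ≈ᵐ N′ → M ⊛ N ≈ᵐ M′ ⊛ N′
  ⊛-cong M≈M′ N≈N′ i k = sum-cong-≋ (λ j → *-cong (M≈M′ i j) (N≈N′ j k))

  ▷-cong : ∀ {d} {M M′ : Matrix d} {v v′} → M ≈ᵐ M′ → v ≈ᵛ v′ → M ▷ v ≈ᵛ M′ ▷ v′
  ▷-cong M≈M′ v≈v′ i = sum-cong-≋ (λ j → *-cong (M≈M′ i j) (v≈v′ j))

  ◁-cong : ∀ {d} {M M′ : Matrix d} {w w′} → w ≈ᵛ w′ → M ≈ᵐ M′ → w ◁ M ≈ᵛ w′ ◁ M′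
  ◁-cong w≈w′ M≈M′ k = sum-cong-≋ (λ i → *-cong (w≈w′ i) (M≈M′ i k))

  ⊛-identityˡ : ∀ {d} {E : Matrix d} N → E ≈ᵐ δ → E ⊛ N ≈ᵐ N
  ⊛-identityˡ {E = E} N E≈δ i k = trans (sum-single _ i offDiag) (trans (*-congʳ (trans (E≈δ i i) (δ-diag i))) (*-identityˡ _))
    where
    offDiag : ∀ j → j ≢ i → E i j * N j k ≈ 0#
    offDiag j j≢i = trans (*-congʳ (trans (E≈δ i j) (δ-off (j≢i ∘ ≡.sym)))) (zeroˡ _)

  ▷-identity : ∀ {d} {E : Matrix d} v → E ≈ᵐ δ → E ▷ v ≈ᵛ v
  ▷-identity v E≈δ i = ⊛-identityˡ (λ k _ → v k) E≈δ i i

  ◁-identity : ∀ {d} {E : Matrix d} w → E ≈ᵐ δ → w ◁ E ≈ᵛ w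
  ◁-identity {E = E} w E≈δ k = trans (sum-single _ k offDiag) (trans (*-congˡ (trans (E≈δ k k) (δ-diag k))) (*-identityʳ _))
    where
    offDiag : ∀ i → i ≢ k → w i * E i k ≈ 0#
    offDiag i i≢k = trans (*-congˡ (trans (E≈δ i k) (δ-off i≢k))) (zeroʳ _)

  ▷-triangular : ∀ {d} (M : Matrix d) v i → (∀ j → j Fin.< i → M i j ≈ 0#) → (∀ j → i Fin.< j → v j ≈ 0#) →
                 (M ▷ v) i ≈ M i i * v i
  ▷-triangular M v i lower upper = sum-single _ i offDiag
    where
    offDiag : ∀ j → j ≢ i → M i j * v j ≈ 0#
    offDiag j j≢i with FinP.<-cmp j i
    ... | tri< j<i _ _ = trans (*-congʳ (lower j j<i)) (zeroˡ _)
    ... | tri≈ _ j≡i _ = ⊥-elim (j≢i j≡i)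
    ... | tri> _ _ i<j = trans (*-congˡ (upper j i<j)) (zeroʳ _)

  ◁-triangular : ∀ {d} w (M : Matrix d) k → (∀ i → i Fin.< k → w i ≈ 0#) → (∀ i → k Fin.< i → M i k ≈ 0#) →
                 (w ◁ M) k ≈ w k * M k k
  ◁-triangular w M k lower upper = sum-single _ k offDiag
    where
    offDiag : ∀ i → i ≢ k → w i * M i k ≈ 0#
    offDiag i i≢k with FinP.<-cmp i k
    ... | tri< i<k _ _ = trans (*-congʳ (lower i i<k)) (zeroˡ _)
    ... | tri≈ _ i≡k _ = ⊥-elim (i≢k i≡k)
    ... | tri> _ _ k<i = trans (*-congˡ (upper i k<i)) (zeroʳ _)

  diag : ∀ {d} → Vector d → Matrix d
  diag a i j = δ i j * a j

  ⊛-diagʳ : ∀ {d} (M : Matrix d) a → M ⊛ diag a ≈ᵐ λ i j → M i j * a j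
  ⊛-diagʳ M a i j = trans (sum-single _ j offDiag) (*-congˡ (trans (*-congʳ (δ-diag j)) (*-identityˡ _)))
    where
    offDiag : ∀ k → k ≢ j → M i k * (δ k j * a j) ≈ 0#
    offDiag k k≢j = trans (*-congˡ (trans (*-congʳ (δ-off k≢j)) (zeroˡ _))) (zeroʳ _)

  ◁-diag : ∀ {d} w (a : Vector d) → w ◁ diag a ≈ᵛ λ j → w j * a j
  ◁-diag w a j = ⊛-diagʳ (λ _ i → w i) a j j

  diag-⊛-diag : ∀ {d} (a b : Vector d) → diag a ⊛ diag b ≈ᵐ diag (λ j → a j * b j)
  diag-⊛-diag a b i j = trans (⊛-diagʳ (diag a) b i j) (*-assoc _ _ _)

  diag-cong : ∀ {d} {a b : Vector d} → a ≈ᵛ b → diag a ≈ᵐ diag b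
  diag-cong a≈b i j = *-congˡ (a≈b j)

  ⊛-scalar : ∀ {d} (M N : Matrix d) x → (M ⊛ diag (λ _ → x)) ⊛ N ≈ᵐ λ i k → x * (M ⊛ N) i k
  ⊛-scalar {d} M N x i k = begin
    sum (λ j → (M ⊛ diag (λ _ → x)) i j * N j k) ≈⟨ sum-cong-≋ {d} (λ j → *-congʳ (⊛-diagʳ M (λ _ → x) i j)) ⟩
    sum (λ j → M i j * x * N j k)               ≈⟨ sum-cong-≋ {d} (λ j → x*y*z≈y*[x*z] _ _ _) ⟩
    sum (λ j → x * (M i j * N j k))             ≈⟨ *-distribˡ-sum {d} _ _ ⟨
    x * sum (λ j → M i j * N j k)               ∎
    where
    x*y*z≈y*[x*z] : ∀ a b e → a * b * e ≈ b * (a * e)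
    x*y*z≈y*[x*z] a b e = trans (*-congʳ (*-comm a b)) (*-assoc b a e)

  _ᵀ : ∀ {d} → Matrix d → Matrix d
  (M ᵀ) i j = M j i

  ◁-as-▷ : ∀ {d} w (M : Matrix d) → w ◁ M ≈ᵛ M ᵀ ▷ w
  ◁-as-▷ {d} w M k = sum-cong-≋ {d} (λ i → *-comm _ _)

  sum-minus-scaled : ∀ {d} (f g : Vector d) c → sum (λ j → f j - c * g j) ≈ sum f - c * sum g
  sum-minus-scaled {d} f g c = begin
    sum (λ j → f j - c * g j)         ≈⟨ sum-cong-≋ {d} (λ j → +-congˡ (-‿distribˡ-* c (g j))) ⟩
    sum (λ j → f j + (- c) * g j)     ≈⟨ ∑-distrib-+ {d} _ _ ⟩
    sum f + sum (λ j → (- c) * g j)   ≈⟨ +-congˡ (*-distribˡ-sum {d} _ _) ⟨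
    sum f + (- c) * sum g             ≈⟨ +-congˡ (-‿distribˡ-* c (sum g)) ⟨
    sum f - c * sum g                 ∎

  ▷-minus-rank-one : ∀ {d} (G : Matrix d) (a b v : Vector d) i →
                     ((λ i j → G i j - a i * b j) ▷ v) i ≈ (G ▷ v) i - a i * sum (λ j → b j * v j)
  ▷-minus-rank-one {d} G a b v i = trans (sum-cong-≋ {d} distribute) (sum-minus-scaled {d} _ _ (a i))
    where
    distribute : ∀ j → (G i j - a i * b j) * v j ≈ G i j * v j - a i * (b j * v j)
    distribute j = trans (distribʳ _ _ _) (+-congˡ (trans (sym (-‿distribˡ-* _ _)) (-‿cong (*-assoc _ _ _))))

  ▷-minus-basis : ∀ {d} (G : Matrix d) (v : Vector d) k x i →
                  (G ▷ (λ j → v j - δ j k * x)) i ≈ (G ▷ v) i - x * G i k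
  ▷-minus-basis {d} G v k x i = begin
    sum (λ j → G i j * (v j - δ j k * x))   ≈⟨ sum-cong-≋ {d} distribute ⟩
    sum (λ j → G i j * v j - x * (G i j * δ j k))   ≈⟨ sum-minus-scaled {d} _ _ x ⟩
    (G ▷ v) i - x * sum (λ j → G i j * δ j k)      ≈⟨ +-congˡ (-‿cong (*-congˡ (⊛-δ G i k))) ⟩
    (G ▷ v) i - x * G i k                          ∎
    where
    distribute : ∀ j → G i j * (v j - δ j k * x) ≈ G i j * v j - x * (G i j * δ j k)
    distribute j = trans (distribˡ _ _ _)
      (+-congˡ (trans (sym (-‿distribʳ-* _ _)) (-‿cong (trans (*-congˡ (*-comm _ _)) (x*[y*z]≈y*[x*z] _ _ _)))))
      where
      x*[y*z]≈y*[x*z] : ∀ a b e → a * (b * e) ≈ b * (a * e)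
      x*[y*z]≈y*[x*z] a b e = trans (sym (*-assoc a b e)) (trans (*-congʳ (*-comm a b)) (*-assoc b a e))

module SubsetFacts where
  open import Data.Fin.Subset using (Subset; _∈_; _∉_; _-_; ∣_∣; ∁; inside; outside)
  open import Data.Fin.Subset.Properties using (p─⊥≡p; ∣∁p∣≡n∸∣p∣; ∣p∣≤n)
  open import Data.Vec.Base using (_∷_; here; there)

  ∣p∣≡1+∣p-x∣ : ∀ {n} {p : Subset n} {x} → x ∈ p → ∣ p ∣ ≡ suc ∣ p - x ∣
  ∣p∣≡1+∣p-x∣ {p = inside  ∷ p} here        = ≡.cong suc (≡.cong ∣_∣ (≡.sym (p─⊥≡p p)))
  ∣p∣≡1+∣p-x∣ {p = inside  ∷ p} (there x∈p) = ≡.cong suc (∣p∣≡1+∣p-x∣ x∈p)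
  ∣p∣≡1+∣p-x∣ {p = outside ∷ p} (there x∈p) = ∣p∣≡1+∣p-x∣ x∈p

  x∉p-x : ∀ {n} {p : Subset n} x → x ∉ p - x
  x∉p-x {p = _ ∷ _} Fin.zero    ()
  x∉p-x {p = _ ∷ _} (Fin.suc x) (there x∈p-x) = x∉p-x x x∈p-x

  ∣∁p∣≤∣∁q∣⇒∣q∣≤∣p∣ : ∀ {n} (p q : Subset n) → ∣ ∁ p ∣ ≤ ∣ ∁ q ∣ → ∣ q ∣ ≤ ∣ p ∣
  ∣∁p∣≤∣∁q∣⇒∣q∣≤∣p∣ p q ∣∁p∣≤∣∁q∣ = ℕP.≮⇒≥ λ ∣p∣<∣q∣ →
    ℕP.<⇒≱ (ℕP.∸-monoʳ-< ∣p∣<∣q∣ (∣p∣≤n q)) (≡.subst₂ _≤_ (∣∁p∣≡n∸∣p∣ p) (∣∁p∣≡n∸∣p∣ q) ∣∁p∣≤∣∁q∣)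


-- Proof by Gaussian elimination:
-- a column j₀ ∈ p has a pivot in some row i₀ ∈ q (else the basis vector e_{j₀} is
-- a nonzero kernel element), and clearing column j₀ with that pivot gives an
-- injective system for p ∖ j₀ and q ∖ i₀.  Field equality is not decidable, so
-- the choice of pivot is made under a double negation, which is harmless since
-- the conclusion ≤ on ℕ is decidable.
module RankBound {c ℓ : Level} (F : FiniteField c ℓ) where
  open FiniteField F hiding (zero)
  open Matrices commRing
  open import Algebra.Properties.Ring ring using (-0#≈0#)
  open import Data.Fin.Subset using (Subset; _∈_; _∉_; ∣_∣; ⁅_⁆) renaming (_-_ to _∖_)
  open import Data.Fin.Subset.Properties using (_∈?_; nonempty?; Empty-unique; ∣⊥∣≡0; p─q⊆p; x∈p∧x≢y⇒x∈p-y)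
  open SubsetFacts
  open SetoidReasoning setoid

  SupportedOn : ∀ {n} → Subset n → Vector n → Set ℓ
  SupportedOn p v = ∀ j → j ∉ p → v j ≈ 0#

  InjectiveOn : ∀ {n} → Subset n → Subset n → Matrix n → Set (c ⊔ ℓ)
  InjectiveOn p q G = ∀ v → SupportedOn p v → (∀ i → i ∈ q → (G ▷ v) i ≈ 0#) → ∀ j → v j ≈ 0#

  ¬¬-decide-all : ∀ {a} n (A : Fin n → Set a) → ¬ ¬ (∀ i → Dec (A i))
  ¬¬-decide-all zero    A k = k (λ ())
  ¬¬-decide-all (suc n) A k = ¬¬-excluded-middle λ dec₀ → ¬¬-decide-all n (A ∘ Fin.suc) λ dec →
    k λ { Fin.zero → dec₀ ; (Fin.suc i) → dec i }

  ¬¬-pivot : ∀ {n} (G : Matrix n) q j →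
    ¬ ¬ ((∀ i → i ∈ q → G i j ≈ 0#) ⊎ Σ (Fin n) λ i → i ∈ q × ¬ G i j ≈ 0#)
  ¬¬-pivot {n} G q j = ¬¬-map choose (¬¬-decide-all n (λ i → G i j ≈ 0#))
    where
    choose : (∀ i → Dec (G i j ≈ 0#)) → (∀ i → i ∈ q → G i j ≈ 0#) ⊎ Σ (Fin n) λ i → i ∈ q × ¬ G i j ≈ 0#
    choose dec with FinP.any? (λ i → (i ∈? q) ×-dec ¬? (dec i))
    ... | yes pivot = inj₂ pivot
    ... | no  none  = inj₁ λ i i∈q → decidable-stable (dec i) (λ Gij≉0 → none (i , i∈q , Gij≉0))

  -- A column of p vanishing in the rows q would put e_j in the kernel.
  no-zero-column : ∀ {n} {p q : Subset n} {G : Matrix n} {j} →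
    InjectiveOn p q G → j ∈ p → ¬ (∀ i → i ∈ q → G i j ≈ 0#)
  no-zero-column {p = p} {q} {G} {j} inj j∈p column≈0 = nontrivial (trans (sym (δ-diag j)) (inj eⱼ eⱼ-supp Geⱼ≈0 j))
    where
    eⱼ : Vector _
    eⱼ k = δ k j
    eⱼ-supp : SupportedOn p eⱼ
    eⱼ-supp k k∉p = δ-off {i = k} {j} λ { ≡.refl → k∉p j∈p }
    Geⱼ≈0 : ∀ i → i ∈ q → (G ▷ eⱼ) i ≈ 0#
    Geⱼ≈0 i i∈q = trans (⊛-δ G i j) (column≈0 i i∈q)

  eliminate : ∀ {n} → Matrix n → Fin n → Fin n → Carrier → Matrix n
  eliminate G i₀ j₀ y i j = G i j - (G i j₀ * y) * G i₀ j

  eliminate-injective : ∀ {n} {p q : Subset n} {G : Matrix n} {i₀ j₀ y} →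
    InjectiveOn p q G → j₀ ∈ p → i₀ ∈ q → G i₀ j₀ * y ≈ 1# →
    InjectiveOn (p ∖ j₀) (q ∖ i₀) (eliminate G i₀ j₀ y)
  eliminate-injective {n} {p} {q} {G} {i₀} {j₀} {y} inj j₀∈p i₀∈q pivot v v-supp G′v≈0 = v≈0
    where
    G′ = eliminate G i₀ j₀ y
    -- v corrected in coordinate j₀, chosen so that G ṽ = G′ v
    ṽ : Vector n
    ṽ j = v j - δ j j₀ * (y * (G ▷ v) i₀)
    Gṽ≈G′v : ∀ i → (G ▷ ṽ) i ≈ (G′ ▷ v) i
    Gṽ≈G′v i = begin
      (G ▷ ṽ) i                                            ≈⟨ ▷-minus-basis G v j₀ _ i ⟩
      (G ▷ v) i - (y * (G ▷ v) i₀) * G i j₀                ≈⟨ +-congˡ (-‿cong (trans (*-comm _ _) (sym (*-assoc _ _ _)))) ⟩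
      (G ▷ v) i - (G i j₀ * y) * sum (λ j → G i₀ j * v j)  ≈⟨ ▷-minus-rank-one G (λ i → G i j₀ * y) (G i₀) v i ⟨
      (G′ ▷ v) i                                           ∎
    G′-row₀ : ∀ j → G′ i₀ j ≈ 0#
    G′-row₀ j = trans (+-congˡ (-‿cong (trans (*-congʳ pivot) (*-identityˡ _)))) (-‿inverseʳ _)
    Gṽ≈0 : ∀ i → i ∈ q → (G ▷ ṽ) i ≈ 0#
    Gṽ≈0 i i∈q with i Fin.≟ i₀
    ... | yes ≡.refl = trans (Gṽ≈G′v i) (sum-zero _ λ j → trans (*-congʳ (G′-row₀ j)) (zeroˡ _))
    ... | no  i≢i₀   = trans (Gṽ≈G′v i) (G′v≈0 i (x∈p∧x≢y⇒x∈p-y i∈q i≢i₀))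
    ṽ-off : ∀ j → j ≢ j₀ → ṽ j ≈ v j
    ṽ-off j j≢j₀ = trans (+-congˡ (trans (-‿cong (trans (*-congʳ (δ-off j≢j₀)) (zeroˡ _))) -0#≈0#)) (+-identityʳ _)
    ṽ-supp : SupportedOn p ṽ
    ṽ-supp j j∉p = trans (ṽ-off j λ { ≡.refl → j∉p j₀∈p }) (v-supp j (j∉p ∘ p─q⊆p p ⁅ j₀ ⁆))
    v≈0 : ∀ j → v j ≈ 0#
    v≈0 j with j Fin.≟ j₀
    ... | yes ≡.refl = v-supp j₀ (x∉p-x j₀)
    ... | no  j≢j₀   = trans (sym (ṽ-off j j≢j₀)) (inj ṽ ṽ-supp Gṽ≈0 j)

  rank-bound : ∀ {n} {p q : Subset n} {G : Matrix n} → InjectiveOn p q G → ∣ p ∣ ≤ ∣ q ∣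
  rank-bound {p = p} = bound ∣ p ∣ ≡.refl
    where
    bound : ∀ {n} k {p q : Subset n} {G : Matrix n} → ∣ p ∣ ≡ k → InjectiveOn p q G → ∣ p ∣ ≤ ∣ q ∣
    bound zero    {q = q} ∣p∣≡0 _ = ≡.subst (_≤ ∣ q ∣) (≡.sym ∣p∣≡0) z≤n
    bound {n} (suc k) {p} {q} {G} ∣p∣≡1+k inj with nonempty? p
    ... | no  p-empty =
      ⊥-elim (ℕP.0≢1+n (≡.trans (≡.sym (∣⊥∣≡0 n)) (≡.trans (≡.cong ∣_∣ (≡.sym (Empty-unique p-empty))) ∣p∣≡1+k)))
    ... | yes (j₀ , j₀∈p) = decidable-stable (∣ p ∣ ℕ.≤? ∣ q ∣) λ ¬bound →
      ¬¬-pivot G q j₀ λ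
        { (inj₁ column≈0)          → no-zero-column inj j₀∈p column≈0
        ; (inj₂ (i₀ , i₀∈q , Gᵢⱼ≉0)) → ¬bound (eliminate-bound i₀∈q (inverse _ Gᵢⱼ≉0)) }
      where
      eliminate-bound : ∀ {i₀} → i₀ ∈ q → Σ Carrier (λ y → G i₀ j₀ * y ≈ 1#) → ∣ p ∣ ≤ ∣ q ∣
      eliminate-bound {i₀} i₀∈q (y , pivot) =
        ≡.subst₂ _≤_ (≡.sym (∣p∣≡1+∣p-x∣ j₀∈p)) (≡.sym (∣p∣≡1+∣p-x∣ i₀∈q))
          (s≤s (bound k ∣p-j₀∣≡k (eliminate-injective {y = y} inj j₀∈p i₀∈q pivot)))
        where
        ∣p-j₀∣≡k : ∣ p ∖ j₀ ∣ ≡ k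
        ∣p-j₀∣≡k = ℕP.suc-injective (≡.trans (≡.sym (∣p∣≡1+∣p-x∣ j₀∈p)) ∣p∣≡1+k)

module SeriesFacts {c ℓ : Level} (F : FiniteField c ℓ) where
  open FiniteField F hiding (zero)
  open PowerSeries F
  open SeriesRing F
  module K = Matrices commRing
  module S = Matrices psRing
  open SetoidReasoning setoid

  constant : Carrier → PS
  constant x zero    = x
  constant x (suc _) = 0#

  constant-zero : ∀ {x} → x ≈ 0# → constant x ≈ₚ 0ₚ
  constant-zero x≈0 zero    = x≈0
  constant-zero x≈0 (suc _) = refl

  *-constant : ∀ f x n → (f *ₚ constant x) n ≈ f n * x
  *-constant f x n = trans (sumTo-single n n _ ℕP.≤-refl onlyLast) (*-congˡ (reflexive (≡.cong (constant x) (ℕP.n∸n≡0 n))))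
    where
    onlyLast : ∀ i → i ≤ n → i ≢ n → f i * constant x (n ∸ i) ≈ 0#
    onlyLast i i≤n i≢n with n ∸ i | ℕP.m<n⇒0<n∸m (ℕP.≤∧≢⇒< i≤n i≢n)
    ... | suc _ | _ = zeroʳ _

  constant-* : ∀ x f n → (constant x *ₚ f) n ≈ x * f n
  constant-* x f n = trans (*ₚ-comm (constant x) f n) (trans (*-constant f x n) (*-comm _ _))

  constant-cong : ∀ {x y} → x ≈ y → constant x ≈ₚ constant y
  constant-cong x≈y zero    = x≈y
  constant-cong x≈y (suc _) = refl

  constant-*ˡ : ∀ x y n → x * constant y n ≈ constant (x * y) n
  constant-*ˡ x y zero    = refl
  constant-*ˡ x y (suc n) = zeroʳ x

  constant-*ʳ : ∀ x y n → constant x n * y ≈ constant (x * y) n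
  constant-*ʳ x y zero    = refl
  constant-*ʳ x y (suc n) = zeroˡ y

  sum-constant : ∀ {d} (a : K.Vector d) n → K.sum (λ k → constant (a k) n) ≈ constant (K.sum a) n
  sum-constant     a zero    = refl
  sum-constant {d} a (suc n) = K.sum-zero {d} _ λ _ → refl

  u^-diag : ∀ t → u^ t t ≈ 1#
  u^-diag t with t ℕ.≟ t
  ... | yes _   = refl
  ... | no  t≢t = ⊥-elim (t≢t ≡.refl)

  u^-off : ∀ t n → n ≢ t → u^ t n ≈ 0#
  u^-off t n n≢t with n ℕ.≟ t
  ... | yes n≡t = ⊥-elim (n≢t n≡t)
  ... | no  _   = refl

  *u^-low : ∀ f t n → n < t → (f *ₚ u^ t) n ≈ 0#
  *u^-low f t n n<t = sumTo-zero n _ λ i _ → trans (*-congˡ (u^-off t (n ∸ i) (ℕP.<⇒≢ (ℕP.≤-<-trans (ℕP.m∸n≤m n i) n<t)))) (zeroʳ _)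

  *u^-shift : ∀ f t n → (f *ₚ u^ t) (n +ℕ t) ≈ f n
  *u^-shift f t n = trans (sumTo-single (n +ℕ t) n _ (ℕP.m≤m+n n t) onlyN) (begin
    f n * u^ t (n +ℕ t ∸ n) ≡⟨ ≡.cong (λ k → f n * u^ t k) (ℕP.m+n∸m≡n n t) ⟩
    f n * u^ t t            ≈⟨ *-congˡ (u^-diag t) ⟩
    f n * 1#                ≈⟨ *-identityʳ _ ⟩
    f n                     ∎)
    where
    onlyN : ∀ i → i ≤ n +ℕ t → i ≢ n → f i * u^ t (n +ℕ t ∸ i) ≈ 0#
    onlyN i i≤n+t i≢n = trans (*-congˡ (u^-off t (n +ℕ t ∸ i) λ n+t-i≡t → i≢n (shifted n+t-i≡t))) (zeroʳ _)
      where
      shifted : n +ℕ t ∸ i ≡ t → i ≡ n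
      shifted eq = ℕP.+-cancelʳ-≡ t i n (≡.trans (ℕP.+-comm i t)
                     (≡.trans (≡.cong (_+ℕ i) (≡.sym eq)) (ℕP.m∸n+n≡m i≤n+t)))

  u^-cancel : ∀ {f t} → (f *ₚ u^ t) ≈ₚ 0ₚ → f ≈ₚ 0ₚ
  u^-cancel {f} {t} fu^t≈0 n = trans (sym (*u^-shift f t n)) (fu^t≈0 (n +ℕ t))

  u^-+ : ∀ a b → (u^ a *ₚ u^ b) ≈ₚ u^ (a +ℕ b)
  u^-+ a b n with b ℕ.≤? n
  ... | no  b≰n = trans (*u^-low (u^ a) b n (ℕP.≰⇒> b≰n)) (sym (u^-off (a +ℕ b) n λ { ≡.refl → b≰n (ℕP.m≤n+m b a) }))
  ... | yes b≤n = ≡.subst (λ k → (u^ a *ₚ u^ b) k ≈ u^ (a +ℕ b) k) (ℕP.m∸n+n≡m b≤n)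
                    (trans (*u^-shift (u^ a) b (n ∸ b)) (shift-u^ (n ∸ b ℕ.≟ a)))
    where
    shift-u^ : Dec (n ∸ b ≡ a) → u^ a (n ∸ b) ≈ u^ (a +ℕ b) (n ∸ b +ℕ b)
    shift-u^ (yes ≡.refl) = trans (u^-diag (n ∸ b)) (sym (u^-diag (n ∸ b +ℕ b)))
    shift-u^ (no  n-b≢a)  = trans (u^-off a (n ∸ b) n-b≢a) (sym (u^-off (a +ℕ b) (n ∸ b +ℕ b) (n-b≢a ∘ ℕP.+-cancelʳ-≡ b (n ∸ b) a)))

  -- Congruence modulo u^s: f ≈[ s ] g when f and g agree below degree s.
  infix 4 _≈[_]_
  _≈[_]_ : PS → ℕ → PS → Set ℓ
  f ≈[ s ] g = ∀ n → n < s → f n ≈ g n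

  modSetoid : ℕ → Setoid c ℓ
  modSetoid s = record
    { Carrier = PS ; _≈_ = _≈[ s ]_
    ; isEquivalence = record
      { refl = λ _ _ → refl ; sym = λ e n n<s → sym (e n n<s) ; trans = λ e e′ n n<s → trans (e n n<s) (e′ n n<s) } }

  ≈ₚ⇒≈[_] : ∀ s {f g} → f ≈ₚ g → f ≈[ s ] g
  ≈ₚ⇒≈[ s ] f≈g n _ = f≈g n

  ≈[]-trans : ∀ {s f g h} → f ≈[ s ] g → g ≈[ s ] h → f ≈[ s ] h
  ≈[]-trans = Setoid.trans (modSetoid _)

  ≈[]-weaken : ∀ {s s′ f g} → s′ ≤ s → f ≈[ s ] g → f ≈[ s′ ] g
  ≈[]-weaken s′≤s f≈g n n<s′ = f≈g n (ℕP.<-≤-trans n<s′ s′≤s)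

  *-congˡ-mod : ∀ {s} f {g g′} → g ≈[ s ] g′ → (f *ₚ g) ≈[ s ] (f *ₚ g′)
  *-congˡ-mod f g≈g′ n n<s = sumTo-cong n λ i i≤n → *-congˡ (g≈g′ (n ∸ i) (ℕP.≤-<-trans (ℕP.m∸n≤m n i) n<s))

  *-congʳ-mod : ∀ {s} f {g g′} → g ≈[ s ] g′ → (g *ₚ f) ≈[ s ] (g′ *ₚ f)
  *-congʳ-mod f {g} {g′} g≈g′ n n<s =
    trans (*ₚ-comm g f n) (trans (*-congˡ-mod f g≈g′ n n<s) (*ₚ-comm f g′ n))

  sum-cong-mod : ∀ {s d} {h h′ : Fin d → PS} → (∀ j → h j ≈[ s ] h′ j) → S.sum h ≈[ s ] S.sum h′
  sum-cong-mod {d = zero}  _      n _   = refl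
  sum-cong-mod {d = suc d} h≈h′ n n<s = +-cong (h≈h′ Fin.zero n n<s) (sum-cong-mod (h≈h′ ∘ Fin.suc) n n<s)

  u^-divides : ∀ {s a} f → s ≤ a → (f *ₚ u^ a) ≈[ s ] 0ₚ
  u^-divides f s≤a n n<s = *u^-low f _ n (ℕP.<-≤-trans n<s s≤a)

  u^-divides-product : ∀ {s a} f g → s ≤ a → ((f *ₚ u^ a) *ₚ g) ≈[ s ] 0ₚ
  u^-divides-product f g s≤a n n<s = trans (*-congʳ-mod g (u^-divides f s≤a) n n<s) (sumTo-zero n _ λ _ _ → zeroˡ _)

  sum-zero-mod : ∀ {s d} {h : Fin d → PS} → (∀ j → h j ≈[ s ] 0ₚ) → S.sum h ≈[ s ] 0ₚ
  sum-zero-mod {d = zero}  _   n _   = refl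
  sum-zero-mod {d = suc d} h≈0 n n<s = trans (+-cong (h≈0 Fin.zero n n<s) (sum-zero-mod (h≈0 ∘ Fin.suc) n n<s)) (+-identityˡ _)

  ▷-cong-mod : ∀ {s d} (G : S.Matrix d) {x y : S.Vector d} → (∀ j → x j ≈[ s ] y j) → ∀ i → (G S.▷ x) i ≈[ s ] (G S.▷ y) i
  ▷-cong-mod G x≈y i = sum-cong-mod λ j → *-congˡ-mod (G i j) (x≈y j)

  ◁-cong-mod : ∀ {s d} (G : S.Matrix d) {x y : S.Vector d} → (∀ j → x j ≈[ s ] y j) → ∀ k → (x S.◁ G) k ≈[ s ] (y S.◁ G) k
  ◁-cong-mod G x≈y k = sum-cong-mod λ i → *-congʳ-mod (G i k) (x≈y i)

  sum-coefficient : ∀ {d} (h : Fin d → PS) n → S.sum h n ≈ K.sum (λ j → h j n)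
  sum-coefficient {zero}  h n = refl
  sum-coefficient {suc d} h n = +-congˡ (sum-coefficient (h ∘ Fin.suc) n)

  sumFin≈sum : ∀ {d} (h : Fin d → PS) → sumFin h ≈ₚ S.sum h
  sumFin≈sum {zero}  h n = refl
  sumFin≈sum {suc d} h n = +-congˡ (sumFin≈sum (h ∘ Fin.suc) n)

  *ₘ≈⊛ : ∀ {d} (X Y : Mat d) → (X *ₘ Y) ≈ₘ (X S.⊛ Y)
  *ₘ≈⊛ X Y i k = sumFin≈sum (λ j → X i j *ₚ Y j k)

  Iₘ≈δ : ∀ {d} → Iₘ {d} ≈ₘ S.δ
  Iₘ≈δ i j with i Fin.≟ j
  ... | yes _ = λ _ → refl
  ... | no  _ = λ _ → refl

  diagU≈diag : ∀ {d} (r : Fin d → ℕ) → diagU r ≈ₘ S.diag (u^ ∘ r)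
  diagU≈diag r i j with i Fin.≟ j
  ... | yes ≡.refl = λ n → sym (*ₚ-identityˡ (u^ (r i)) n)
  ... | no  _      = λ n → sym (sumTo-zero n _ λ _ _ → zeroˡ _)

  coefficient₀ : ∀ {d} → S.Matrix d → K.Matrix d
  coefficient₀ X i j = X i j 0

  inverse₀ : ∀ {d} {X Y : Mat d} → (X *ₘ Y) ≈ₘ Iₘ → coefficient₀ X K.⊛ coefficient₀ Y K.≈ᵐ K.δ
  inverse₀ {X = X} {Y} XY≈I i j = begin
    K.sum (λ k → X i k 0 * Y k j 0) ≈⟨ sum-coefficient (λ k → X i k *ₚ Y k j) 0 ⟨
    (X S.⊛ Y) i j 0                 ≈⟨ *ₘ≈⊛ X Y i j 0 ⟨
    (X *ₘ Y) i j 0                  ≈⟨ XY≈I i j 0 ⟩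
    Iₘ i j 0                        ≈⟨ Iₘ≡δ₀ ⟩
    K.δ i j                         ∎
    where
    Iₘ≡δ₀ : Iₘ i j 0 ≈ K.δ i j
    Iₘ≡δ₀ with i Fin.≟ j
    ... | yes _ = refl
    ... | no  _ = refl

  ∈k[[u^p]]⇒≈constant : ∀ {p f} → In-k[[u^p]] p f → f ≈[ p ] constant (f 0)
  ∈k[[u^p]]⇒≈constant f∈ zero    _     = refl
  ∈k[[u^p]]⇒≈constant f∈ (suc n) 1+n<p = f∈ (suc n) λ p∣1+n → ℕP.<⇒≱ 1+n<p (∣⇒≤ p∣1+n)

  ▷-constant : ∀ {p d} (A : S.Matrix d) → (∀ i j → In-k[[u^p]] p (A i j)) → ∀ v j →
               (A S.▷ (constant ∘ v)) j ≈[ p ] constant ((coefficient₀ A K.▷ v) j)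
  ▷-constant {d = d} A A∈ v j n n<p = begin
    S.sum (λ k → A j k *ₚ constant (v k)) n    ≈⟨ sum-coefficient {d} _ n ⟩
    K.sum (λ k → (A j k *ₚ constant (v k)) n)  ≈⟨ K.sum-cong-≋ {d} term ⟩
    K.sum (λ k → constant (A j k 0 * v k) n)   ≈⟨ sum-constant {d} _ n ⟩
    constant ((coefficient₀ A K.▷ v) j) n      ∎
    where
    term : ∀ k → (A j k *ₚ constant (v k)) n ≈ constant (A j k 0 * v k) n
    term k = trans (*-constant _ _ n) (trans (*-congʳ (∈k[[u^p]]⇒≈constant (A∈ j k) n n<p)) (constant-*ʳ _ _ n))

  ◁-constant : ∀ {p d} (A : S.Matrix d) → (∀ i j → In-k[[u^p]] p (A i j)) → ∀ w k →
               ((constant ∘ w) S.◁ A) k ≈[ p ] constant ((w K.◁ coefficient₀ A) k)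
  ◁-constant {d = d} A A∈ w k n n<p = begin
    S.sum (λ i → constant (w i) *ₚ A i k) n    ≈⟨ sum-coefficient {d} _ n ⟩
    K.sum (λ i → (constant (w i) *ₚ A i k) n)  ≈⟨ K.sum-cong-≋ {d} term ⟩
    K.sum (λ i → constant (w i * A i k 0) n)   ≈⟨ sum-constant {d} _ n ⟩
    constant ((w K.◁ coefficient₀ A) k) n      ∎
    where
    term : ∀ i → (constant (w i) *ₚ A i k) n ≈ constant (w i * A i k 0) n
    term i = trans (constant-* (w i) (A i k) n) (trans (*-congˡ (∈k[[u^p]]⇒≈constant (A∈ i k) n n<p)) (constant-*ˡ _ _ n))

module Triangular {c ℓ : Level} (F : FiniteField c ℓ) where
  open FiniteField F hiding (zero)
  open PowerSeries F
  open SeriesRing F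
  open SeriesFacts F
  open import Relation.Binary.Reasoning.MultiSetoid

  UpperTriangular : ∀ {d} → S.Matrix d → Set ℓ
  UpperTriangular T = ∀ i j → j Fin.< i → T i j ≈ₚ 0ₚ

  cancel : ∀ {x y z} → x * y ≈ 1# → x * z ≈ 0# → z ≈ 0#
  cancel {x} {y} {z} xy≈1 xz≈0 = begin⟨ setoid ⟩
    z             ≈⟨ *-identityˡ z ⟨
    1# * z        ≈⟨ *-congʳ (trans (sym xy≈1) (*-comm x y)) ⟩
    (y * x) * z   ≈⟨ *-assoc y x z ⟩
    y * (x * z)   ≈⟨ *-congˡ xz≈0 ⟩
    y * 0#        ≈⟨ zeroʳ y ⟩
    0#            ∎

  -- Let T be upper triangular whose diagonal entry T i i has an invertible
  -- coefficient in degree e i.  A constant vector v with T v ≡ 0 (mod u^s) is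
  -- zero, provided v i ≈ 0 is already known whenever e i ≥ s: by descending
  -- induction, row i of T v is (T i i) (v i), whose coefficient in degree e i < s
  -- is an invertible multiple of v i.
  column-pivot : ∀ {d} {T : S.Matrix d} → UpperTriangular T → (e : Fin d → ℕ) →
    (∀ i → Σ Carrier λ y → T i i (e i) * y ≈ 1#) → ∀ s (v : K.Vector d) →
    (∀ i → (T S.▷ (constant ∘ v)) i ≈[ s ] 0ₚ) → (∀ i → e i < s ⊎ v i ≈ 0#) → ∀ i → v i ≈ 0#
  column-pivot {d} {T} upper e unit s v Tv≈0 small-or-zero = All.wfRec >-wellFounded ℓ (λ i → v i ≈ 0#) step
    where
    step : ∀ i → (∀ {j} → j Fin.> i → v j ≈ 0#) → v i ≈ 0#
    step i v>ᵢ≈0 with small-or-zero i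
    ... | inj₂ vᵢ≈0 = vᵢ≈0
    ... | inj₁ eᵢ<s = cancel (proj₂ (unit i)) (begin⟨ setoid ⟩
      T i i (e i) * v i                 ≈⟨ *-constant (T i i) (v i) (e i) ⟨
      (T i i *ₚ constant (v i)) (e i)   ≈⟨ row-i (e i) ⟨
      (T S.▷ (constant ∘ v)) i (e i)    ≈⟨ Tv≈0 i (e i) eᵢ<s ⟩
      0#                                ∎)
      where
      row-i : (T S.▷ (constant ∘ v)) i ≈ₚ (T i i *ₚ constant (v i))
      row-i = S.▷-triangular T (constant ∘ v) i (upper i) (λ j i<j → constant-zero (v>ᵢ≈0 i<j))

  row-pivot : ∀ {d} {T : S.Matrix d} → UpperTriangular T → (e : Fin d → ℕ) →
    (∀ k → Σ Carrier λ y → T k k (e k) * y ≈ 1#) → ∀ s (w : K.Vector d) →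
    (∀ k → ((constant ∘ w) S.◁ T) k ≈[ s ] 0ₚ) → (∀ k → e k < s ⊎ w k ≈ 0#) → ∀ k → w k ≈ 0#
  row-pivot {d} {T} upper e unit s w wT≈0 small-or-zero = All.wfRec <-wellFounded ℓ (λ k → w k ≈ 0#) step
    where
    step : ∀ k → (∀ {i} → i Fin.< k → w i ≈ 0#) → w k ≈ 0#
    step k w<ₖ≈0 with small-or-zero k
    ... | inj₂ wₖ≈0 = wₖ≈0
    ... | inj₁ eₖ<s = cancel (proj₂ (unit k)) (begin⟨ setoid ⟩
      T k k (e k) * w k                 ≈⟨ *-comm _ _ ⟩
      w k * T k k (e k)                 ≈⟨ constant-* (w k) (T k k) (e k) ⟨
      (constant (w k) *ₚ T k k) (e k)   ≈⟨ column-k (e k) ⟨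
      ((constant ∘ w) S.◁ T) k (e k)    ≈⟨ wT≈0 k (e k) eₖ<s ⟩
      0#                                ∎)
      where
      column-k : ((constant ∘ w) S.◁ T) k ≈ₚ (constant (w k) *ₚ T k k)
      column-k = S.◁-triangular (constant ∘ w) T k (λ i i<k → constant-zero (w<ₖ≈0 i<k)) (λ i k<i → upper i k k<i)

  module TriangularInverse {d} {T X : S.Matrix d} (cs gs : Fin d → PS) (t : Fin d → ℕ) (p : ℕ)
      (upper : UpperTriangular T) (diagonal : ∀ i → T i i ≈ₚ (cs i *ₚ u^ (t i)))
      (unit : ∀ i → (cs i *ₚ gs i) ≈ₚ 1ₚ) (TX≈u^p : ∀ i j → (T S.⊛ X) i j ≈ₚ S.diag (λ _ → u^ p) i j) where
    private module P = CommutativeRing psRing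

    divide-diagonal : ∀ i {x y} → ((cs i *ₚ u^ (t i)) *ₚ x) ≈ₚ y → (x *ₚ u^ (t i)) ≈ₚ (gs i *ₚ y)
    divide-diagonal i {x} {y} cu^x≈y = begin⟨ P.setoid ⟩
      x *ₚ u^ (t i)                         ≈⟨ P.*-comm _ _ ⟩
      u^ (t i) *ₚ x                         ≈⟨ P.*-identityˡ _ ⟨
      1ₚ *ₚ (u^ (t i) *ₚ x)                 ≈⟨ P.*-congʳ {u^ (t i) *ₚ x} (P.trans (P.sym (unit i)) (P.*-comm (cs i) (gs i))) ⟩
      (gs i *ₚ cs i) *ₚ (u^ (t i) *ₚ x)     ≈⟨ P.*-assoc (gs i) (cs i) (u^ (t i) *ₚ x) ⟩
      gs i *ₚ (cs i *ₚ (u^ (t i) *ₚ x))     ≈⟨ P.*-congˡ {gs i} (P.*-assoc (cs i) (u^ (t i)) x) ⟨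
      gs i *ₚ ((cs i *ₚ u^ (t i)) *ₚ x)     ≈⟨ P.*-congˡ {gs i} cu^x≈y ⟩
      gs i *ₚ y                             ∎

    TX-entry : ∀ i j → (∀ k → i Fin.< k → X k j ≈ₚ 0ₚ) → ((cs i *ₚ u^ (t i)) *ₚ X i j) ≈ₚ S.diag (λ _ → u^ p) i j
    TX-entry i j below≈0 =
      P.trans (P.*-congʳ {X i j} (P.sym (diagonal i))) (P.trans (P.sym (S.▷-triangular T (λ k → X k j) i (upper i) below≈0)) (TX≈u^p i j))

    X-upper : UpperTriangular X
    X-upper = All.wfRec >-wellFounded ℓ (λ i → ∀ j → j Fin.< i → X i j ≈ₚ 0ₚ) step
      where
      step : ∀ i → (∀ {k} → k Fin.> i → ∀ j → j Fin.< k → X k j ≈ₚ 0ₚ) → ∀ j → j Fin.< i → X i j ≈ₚ 0ₚ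
      step i X>ᵢ≈0 j j<i = u^-cancel (P.trans (divide-diagonal i cu^Xᵢⱼ≈0) (P.zeroʳ (gs i)))
        where
        cu^Xᵢⱼ≈0 : ((cs i *ₚ u^ (t i)) *ₚ X i j) ≈ₚ 0ₚ
        cu^Xᵢⱼ≈0 = P.trans (TX-entry i j (λ k i<k → X>ᵢ≈0 i<k j (ℕP.<-trans j<i i<k)))
                           (P.trans (P.*-congʳ {u^ p} (S.δ-off {i = i} {j} (FinP.<⇒≢ j<i ∘ ≡.sym))) (P.zeroˡ (u^ p)))

    X-diagonal : ∀ i → (X i i *ₚ u^ (t i)) ≈ₚ (gs i *ₚ u^ p)
    X-diagonal i = divide-diagonal i
      (P.trans (TX-entry i i (λ k i<k → X-upper k i i<k)) (P.trans (P.*-congʳ {u^ p} (S.δ-diag i)) (P.*-identityˡ (u^ p))))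

    -- c i 0 · g i 0 = 1, so g i 0 ≠ 0; comparing coefficients of u^p forces t i ≤ p.
    t≤p : ∀ i → t i ≤ p
    t≤p i with t i ℕ.≤? p
    ... | yes tᵢ≤p = tᵢ≤p
    ... | no  tᵢ≰p = ⊥-elim (nontrivial (trans (sym (unit i 0)) (trans (*-congˡ gᵢ₀≈0) (zeroʳ _))))
      where
      gᵢ₀≈0 : gs i 0 ≈ 0#
      gᵢ₀≈0 = trans (sym (*u^-shift (gs i) p 0)) (trans (sym (X-diagonal i p)) (*u^-low (X i i) (t i) p (ℕP.≰⇒> tᵢ≰p)))

    X-pivot : ∀ i → X i i (p ∸ t i) ≈ gs i 0
    X-pivot i = begin⟨ setoid ⟩
      X i i (p ∸ t i)                         ≈⟨ *u^-shift (X i i) (t i) (p ∸ t i) ⟨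
      (X i i *ₚ u^ (t i)) (p ∸ t i +ℕ t i)    ≈⟨ X-diagonal i (p ∸ t i +ℕ t i) ⟩
      (gs i *ₚ u^ p) (p ∸ t i +ℕ t i)         ≈⟨ reflexive (≡.cong (gs i *ₚ u^ p) (ℕP.m∸n+n≡m (t≤p i))) ⟩
      (gs i *ₚ u^ p) p                        ≈⟨ *u^-shift (gs i) p 0 ⟩
      gs i 0                                  ∎

-- The set of values of x : Fin d → ℕ is determined by the sizes of the upper
-- level sets {j | s ≤ x j}: a is a value of x exactly when the level set
-- shrinks from s = a to s = a + 1.
module LevelSets where
  open import Data.Fin.Subset using (Subset; _∈_; ∣_∣)
  open import Data.Fin.Subset.Properties using (p⊆q⇒∣p∣≤∣q∣; p⊂q⇒∣p∣<∣q∣)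
  open import Data.Vec.Base using (tabulate)
  open import Data.Vec.Properties using (lookup∘tabulate; []=⇒lookup; lookup⇒[]=)
  open import Data.Bool.Properties using (T-≡)
  open import Function.Bundles using (Equivalence)

  atLeast : ∀ {d} → (Fin d → ℕ) → ℕ → Subset d
  atLeast x s = tabulate λ j → s ℕ.≤ᵇ x j

  ∈-atLeast⁺ : ∀ {d} (x : Fin d → ℕ) {s j} → s ≤ x j → j ∈ atLeast x s
  ∈-atLeast⁺ x {s} {j} s≤xⱼ = lookup⇒[]= j _ (≡.trans (lookup∘tabulate _ j) (Equivalence.to T-≡ (ℕP.≤⇒≤ᵇ s≤xⱼ)))

  ∈-atLeast⁻ : ∀ {d} (x : Fin d → ℕ) {s j} → j ∈ atLeast x s → s ≤ x j
  ∈-atLeast⁻ x {s} {j} j∈ =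
    ℕP.≤ᵇ⇒≤ s (x j) (Equivalence.from T-≡ (≡.trans (≡.sym (lookup∘tabulate (λ k → s ℕ.≤ᵇ x k) j)) ([]=⇒lookup j∈)))

  value⇒shrinks : ∀ {d} (x : Fin d → ℕ) j → ∣ atLeast x (suc (x j)) ∣ < ∣ atLeast x (x j) ∣
  value⇒shrinks x j = p⊂q⇒∣p∣<∣q∣ ((λ k∈ → ∈-atLeast⁺ x (ℕP.<⇒≤ (∈-atLeast⁻ x k∈))) ,
                                   j , ∈-atLeast⁺ x ℕP.≤-refl , ℕP.<-irrefl ≡.refl ∘ ∈-atLeast⁻ x)

  no-value⇒same : ∀ {d} (x : Fin d → ℕ) a → (∀ j → x j ≢ a) → ∣ atLeast x a ∣ ≤ ∣ atLeast x (suc a) ∣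
  no-value⇒same x a missing = p⊆q⇒∣p∣≤∣q∣ λ {j} j∈ → ∈-atLeast⁺ x (ℕP.≤∧≢⇒< (∈-atLeast⁻ x j∈) (missing j ∘ ≡.sym))

  values-transfer : ∀ {d} (x y : Fin d → ℕ) → (∀ s → ∣ atLeast x s ∣ ≡ ∣ atLeast y s ∣) →
                    ∀ j → Σ (Fin d) λ i → x j ≡ y i
  values-transfer x y same j with FinP.any? (λ i → x j ℕ.≟ y i)
  ... | yes found = found
  ... | no  none  = ⊥-elim (ℕP.<⇒≱ (value⇒shrinks x j)
        (≡.subst₂ _≤_ (≡.sym (same (x j))) (≡.sym (same (suc (x j))))
          (no-value⇒same y (x j) λ i yᵢ≡xⱼ → none (i , ≡.sym yᵢ≡xⱼ))))

module Factorisation {c ℓ : Level} (F : FiniteField c ℓ) where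
  open FiniteField F hiding (zero)
  open PowerSeries F
  open SeriesRing F
  open SeriesFacts F
  open Triangular F
  open RankBound F using (SupportedOn; InjectiveOn; rank-bound)
  open LevelSets
  open SubsetFacts using (∣∁p∣≤∣∁q∣⇒∣q∣≤∣p∣)
  open import Data.Fin.Subset using (∣_∣; ∁)
  open import Data.Fin.Subset.Properties using (p⊆q⇒∣p∣≤∣q∣; x∈p⇒x∉∁p; x∉p⇒x∈∁p)
  open import Relation.Binary.Reasoning.MultiSetoid

  module Setting (p d : ℕ) (M B A : Mat d) (cs : Fin d → PS) (t r : Fin d → ℕ)
      (M-shape : UpperTriangularWithDiag M cs t) (cs-unit : ∀ i → IsUnitₚ (cs i)) (B-invertible : IsGL B)
      (r≤p : ∀ j → r j ≤ p) (A-invertible : IsGL-u^p p A) (M≈BDA : M ≈ₘ ((B *ₘ diagU r) *ₘ A)) where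

    A-entries : ∀ i j → In-k[[u^p]] p (A i j)
    A-entries = proj₁ A-invertible

    N C D D′ X : S.Matrix d
    N  = proj₁ (proj₂ A-invertible)
    C  = proj₁ B-invertible
    D  = S.diag (u^ ∘ r)
    D′ = S.diag (λ j → u^ (p ∸ r j))
    X  = (N S.⊛ D′) S.⊛ C

    N-entries : ∀ i j → In-k[[u^p]] p (N i j)
    N-entries = proj₁ (proj₂ (proj₂ A-invertible))

    A₀ N₀ : K.Matrix d
    A₀ = coefficient₀ A
    N₀ = coefficient₀ N

    gs : Fin d → PS
    gs i = proj₁ (cs-unit i)

    cs-gs≈1 : ∀ i → (cs i *ₚ gs i) ≈ₚ 1ₚ
    cs-gs≈1 i = proj₂ (cs-unit i)

    M≈BDA′ : M S.≈ᵐ (B S.⊛ D) S.⊛ A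
    M≈BDA′ = begin⟨ S.matrixSetoid d ⟩
      M                         ≈⟨ M≈BDA ⟩
      (B *ₘ diagU r) *ₘ A       ≈⟨ *ₘ≈⊛ (B *ₘ diagU r) A ⟩
      (B *ₘ diagU r) S.⊛ A      ≈⟨ S.⊛-cong {M = B *ₘ diagU r} {N = A} {N′ = A} BD≈ (λ _ _ _ → refl) ⟩
      (B S.⊛ D) S.⊛ A           ∎
      where
      BD≈ : (B *ₘ diagU r) S.≈ᵐ B S.⊛ D
      BD≈ = begin⟨ S.matrixSetoid d ⟩
        B *ₘ diagU r     ≈⟨ *ₘ≈⊛ B (diagU r) ⟩
        B S.⊛ diagU r    ≈⟨ S.⊛-cong {M = B} {M′ = B} {N = diagU r} (λ _ _ _ → refl) (diagU≈diag r) ⟩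
        B S.⊛ D          ∎

    AN≈δ : A S.⊛ N S.≈ᵐ S.δ
    AN≈δ i j n = trans (sym (*ₘ≈⊛ A N i j n)) (trans (proj₁ (proj₂ (proj₂ (proj₂ A-invertible))) i j n) (Iₘ≈δ i j n))

    BC≈δ : B S.⊛ C S.≈ᵐ S.δ
    BC≈δ i j n = trans (sym (*ₘ≈⊛ B C i j n)) (trans (proj₁ (proj₂ B-invertible) i j n) (Iₘ≈δ i j n))

    A₀N₀≈δ : A₀ K.⊛ N₀ K.≈ᵐ K.δ
    A₀N₀≈δ = inverse₀ {X = A} {Y = N} (proj₁ (proj₂ (proj₂ (proj₂ A-invertible))))

    M-pivot : ∀ i → Σ Carrier λ y → M i i (t i) * y ≈ 1#
    M-pivot i = gs i 0 , trans (*-congʳ (trans (proj₂ M-shape i (t i)) (*u^-shift (cs i) (t i) 0))) (cs-gs≈1 i 0)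

    -- A N₀ ξ ≡ ξ (mod u^p): on constants A acts through A₀, and A₀ N₀ = 1.
    A-N₀ : ∀ ξ j → (A S.▷ (constant ∘ (N₀ K.▷ ξ))) j ≈[ p ] constant (ξ j)
    A-N₀ ξ j n n<p = trans (▷-constant A A-entries (N₀ K.▷ ξ) j n n<p)
                       (constant-cong (trans (sym (K.▷-assoc A₀ N₀ ξ j)) (K.▷-identity ξ A₀N₀≈δ j)) n)

    M-N₀ : ∀ {s} → s ≤ p → ∀ ξ i → (M S.▷ (constant ∘ (N₀ K.▷ ξ))) i ≈[ s ] ((B S.⊛ D) S.▷ (constant ∘ ξ)) i
    M-N₀ {s} s≤p ξ i = begin⟨ modSetoid s ⟩
      (M S.▷ v̂) i                     ≈⟨ ≈ₚ⇒≈[ s ] (S.▷-cong {v = v̂} {v′ = v̂} M≈BDA′ (λ _ _ → refl) i) ⟩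
      (((B S.⊛ D) S.⊛ A) S.▷ v̂) i     ≈⟨ ≈ₚ⇒≈[ s ] (S.▷-assoc (B S.⊛ D) A v̂ i) ⟩
      ((B S.⊛ D) S.▷ A S.▷ v̂) i       ≈⟨ ≈[]-weaken s≤p (▷-cong-mod (B S.⊛ D) (A-N₀ ξ) i) ⟩
      ((B S.⊛ D) S.▷ (constant ∘ ξ)) i ∎
      where
      v̂ : S.Vector d
      v̂ = constant ∘ (N₀ K.▷ ξ)

    -- B D ξ = (B_ij u^{r_j} ξ_j) ≡ 0 (mod u^s) when ξ is supported on {j | s ≤ r j}.
    BD-supported : ∀ s ξ → SupportedOn (atLeast r s) ξ → ∀ i → ((B S.⊛ D) S.▷ (constant ∘ ξ)) i ≈[ s ] 0ₚ
    BD-supported s ξ ξ-supp i = sum-zero-mod term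
      where
      term : ∀ j → ((B S.⊛ D) i j *ₚ constant (ξ j)) ≈[ s ] 0ₚ
      term j n n<s with s ℕ.≤? r j
      ... | yes s≤rⱼ = trans (*ₚ-cong {g = constant (ξ j)} {g′ = constant (ξ j)} (S.⊛-diagʳ B (u^ ∘ r) i j) (λ _ → refl) n)
                             (u^-divides-product (B i j) (constant (ξ j)) s≤rⱼ n n<s)
      ... | no  s≰rⱼ = trans (*ₚ-cong {f = (B S.⊛ D) i j} {f′ = (B S.⊛ D) i j} (λ _ → refl)
                                     (constant-zero (ξ-supp j (s≰rⱼ ∘ ∈-atLeast⁻ r))) n)
                             (sumTo-zero n _ λ _ _ → zeroʳ _)

    -- For ξ supported on
    -- {j | s ≤ r j} the constant vector v = N₀ ξ has M v ≡ 0 (mod u^s); by the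
    -- column pivot lemma v = 0 once v i = 0 for s ≤ t i, and then ξ = A₀ v = 0.
    injective-I : ∀ s → InjectiveOn (atLeast r s) (atLeast t s) N₀
    injective-I s ξ ξ-supp N₀ξ≈0 j with s ℕ.≤? p
    ... | no  s≰p = ξ-supp j (s≰p ∘ (λ s≤rⱼ → ℕP.≤-trans s≤rⱼ (r≤p j)) ∘ ∈-atLeast⁻ r)
    ... | yes s≤p = begin⟨ setoid ⟩
      ξ j                     ≈⟨ K.▷-identity ξ A₀N₀≈δ j ⟨
      ((A₀ K.⊛ N₀) K.▷ ξ) j   ≈⟨ K.▷-assoc A₀ N₀ ξ j ⟩
      (A₀ K.▷ v) j            ≈⟨ K.sum-zero _ (λ k → trans (*-congˡ (v≈0 k)) (zeroʳ _)) ⟩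
      0#                      ∎
      where
      v : K.Vector d
      v = N₀ K.▷ ξ
      Mv≈0 : ∀ i → (M S.▷ (constant ∘ v)) i ≈[ s ] 0ₚ
      Mv≈0 i = ≈[]-trans (M-N₀ s≤p ξ i) (BD-supported s ξ ξ-supp i)
      small-or-zero : ∀ i → t i < s ⊎ v i ≈ 0#
      small-or-zero i with s ℕ.≤? t i
      ... | yes s≤tᵢ = inj₂ (N₀ξ≈0 i (∈-atLeast⁺ t s≤tᵢ))
      ... | no  s≰tᵢ = inj₁ (ℕP.≰⇒> s≰tᵢ)
      v≈0 : ∀ i → v i ≈ 0#
      v≈0 = column-pivot (proj₁ M-shape) t M-pivot s v Mv≈0 small-or-zero

    -- X = N D′ C inverts M up to the scalar u^p: M X = B D (A N) D′ C = B (D D′) C = u^p B C.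
    MX≈u^p : M S.⊛ X S.≈ᵐ S.diag (λ _ → u^ p)
    MX≈u^p = begin⟨ S.matrixSetoid d ⟩
      M S.⊛ X                                              ≈⟨ S.⊛-cong {N = X} {N′ = X} M≈BDA′ refl′ ⟩
      ((B S.⊛ D) S.⊛ A) S.⊛ ((N S.⊛ D′) S.⊛ C)             ≈⟨ S.⊛-assoc (B S.⊛ D) A X ⟩
      (B S.⊛ D) S.⊛ (A S.⊛ ((N S.⊛ D′) S.⊛ C))             ≈⟨ S.⊛-cong {M = B S.⊛ D} {M′ = B S.⊛ D} refl′ ANDC ⟩
      (B S.⊛ D) S.⊛ (D′ S.⊛ C)                             ≈⟨ S.⊛-assoc (B S.⊛ D) D′ C ⟨
      ((B S.⊛ D) S.⊛ D′) S.⊛ C                             ≈⟨ S.⊛-cong {N = C} {N′ = C} BDD′ refl′ ⟩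
      (B S.⊛ S.diag (λ _ → u^ p)) S.⊛ C                    ≈⟨ S.⊛-scalar B C (u^ p) ⟩
      (λ i k → u^ p *ₚ (B S.⊛ C) i k)                      ≈⟨ scaled-δ ⟩
      S.diag (λ _ → u^ p)                                  ∎
      where
      refl′ : ∀ {Y : S.Matrix d} → Y S.≈ᵐ Y
      refl′ _ _ _ = refl
      ANDC : A S.⊛ ((N S.⊛ D′) S.⊛ C) S.≈ᵐ D′ S.⊛ C
      ANDC = begin⟨ S.matrixSetoid d ⟩
        A S.⊛ ((N S.⊛ D′) S.⊛ C)   ≈⟨ S.⊛-assoc A (N S.⊛ D′) C ⟨
        (A S.⊛ (N S.⊛ D′)) S.⊛ C   ≈⟨ S.⊛-cong {N = C} {N′ = C} (S.⊛-assoc A N D′) refl′ ⟨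
        ((A S.⊛ N) S.⊛ D′) S.⊛ C   ≈⟨ S.⊛-cong {N = C} {N′ = C} (S.⊛-identityˡ D′ AN≈δ) refl′ ⟩
        D′ S.⊛ C                   ∎
      DD′ : D S.⊛ D′ S.≈ᵐ S.diag (λ _ → u^ p)
      DD′ i j = (CommutativeRing.trans psRing) (S.diag-⊛-diag (u^ ∘ r) (λ j → u^ (p ∸ r j)) i j)
        (S.diag-cong (λ j n → trans (u^-+ (r j) (p ∸ r j) n) (reflexive (≡.cong (λ e → u^ e n) (ℕP.m+[n∸m]≡n (r≤p j))))) i j)
      BDD′ : (B S.⊛ D) S.⊛ D′ S.≈ᵐ B S.⊛ S.diag (λ _ → u^ p)
      BDD′ = begin⟨ S.matrixSetoid d ⟩
        (B S.⊛ D) S.⊛ D′   ≈⟨ S.⊛-assoc B D D′ ⟩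
        B S.⊛ (D S.⊛ D′)   ≈⟨ S.⊛-cong {M = B} {M′ = B} refl′ DD′ ⟩
        B S.⊛ S.diag (λ _ → u^ p) ∎
      scaled-δ : (λ i k → u^ p *ₚ (B S.⊛ C) i k) S.≈ᵐ S.diag (λ _ → u^ p)
      scaled-δ i k n = trans (*ₚ-cong {f = u^ p} {f′ = u^ p} (λ _ → refl) (BC≈δ i k) n) (*ₚ-comm (u^ p) (S.δ i k) n)

    open TriangularInverse {T = M} {X = X} cs gs t p (proj₁ M-shape) (proj₂ M-shape) cs-gs≈1 MX≈u^p
      using (X-upper; X-pivot; t≤p)

    X-unit : ∀ k → Σ Carrier λ y → X k k (p ∸ t k) * y ≈ 1#
    X-unit k = cs k 0 , trans (*-congʳ (X-pivot k)) (trans (*-comm _ _) (cs-gs≈1 k 0))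

    A₀-N : ∀ ξ j → ((constant ∘ (ξ K.◁ A₀)) S.◁ N) j ≈[ p ] constant (ξ j)
    A₀-N ξ j n n<p = trans (◁-constant N N-entries (ξ K.◁ A₀) j n n<p)
                       (constant-cong (trans (sym (K.◁-assoc ξ A₀ N₀ j)) (K.◁-identity ξ A₀N₀≈δ j)) n)

    A₀-X : ∀ {s} → s ≤ p → ∀ ξ k → ((constant ∘ (ξ K.◁ A₀)) S.◁ X) k ≈[ s ] ((constant ∘ ξ) S.◁ D′ S.◁ C) k
    A₀-X {s} s≤p ξ k = begin⟨ modSetoid s ⟩
      (ŵ S.◁ X) k                  ≈⟨ ≈ₚ⇒≈[ s ] (S.◁-assoc ŵ (N S.⊛ D′) C k) ⟩
      (ŵ S.◁ (N S.⊛ D′) S.◁ C) k   ≈⟨ ≈ₚ⇒≈[ s ] (S.◁-cong {M = C} {M′ = C} (S.◁-assoc ŵ N D′) (λ _ _ _ → refl) k) ⟩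
      (ŵ S.◁ N S.◁ D′ S.◁ C) k     ≈⟨ ≈[]-weaken s≤p (◁-cong-mod C (◁-cong-mod D′ (A₀-N ξ)) k) ⟩
      ((constant ∘ ξ) S.◁ D′ S.◁ C) k ∎
      where
      ŵ : S.Vector d
      ŵ = constant ∘ (ξ K.◁ A₀)

    -- ξ D′ C ≡ 0 (mod u^(p - m)) when ξ is supported on {j | r j ≤ m}, since the
    -- j-th entry of ξ D′ is ξ_j u^{p - r_j}.
    D′C-supported : ∀ m ξ → SupportedOn (∁ (atLeast r (suc m))) ξ →
                    ∀ k → ((constant ∘ ξ) S.◁ D′ S.◁ C) k ≈[ p ∸ m ] 0ₚ
    D′C-supported m ξ ξ-supp k = sum-zero-mod λ j n n<s →
      trans (*-congʳ-mod (C j k) (ξD′≈0 j) n n<s) (sumTo-zero n _ λ _ _ → zeroˡ _)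
      where
      ξD′≈0 : ∀ j → ((constant ∘ ξ) S.◁ D′) j ≈[ p ∸ m ] 0ₚ
      ξD′≈0 j n n<s with r j ℕ.≤? m
      ... | yes rⱼ≤m = trans (S.◁-diag (constant ∘ ξ) (λ j → u^ (p ∸ r j)) j n)
                             (u^-divides (constant (ξ j)) (ℕP.∸-monoʳ-≤ p rⱼ≤m) n n<s)
      ... | no  rⱼ≰m = trans (S.◁-diag (constant ∘ ξ) (λ j → u^ (p ∸ r j)) j n)
                         (trans (*ₚ-cong {g = u^ (p ∸ r j)} {g′ = u^ (p ∸ r j)} (constant-zero ξⱼ≈0) (λ _ → refl) n)
                                (sumTo-zero n _ λ _ _ → zeroˡ _))
        where ξⱼ≈0 = ξ-supp j (x∈p⇒x∉∁p (∈-atLeast⁺ r (ℕP.≰⇒> rⱼ≰m)))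

    -- For a row vector ξ
    -- supported on {j | r j ≤ m} the constant row vector w = ξ A₀ has w X ≡ 0
    -- (mod u^(p - m)); by the row pivot lemma for the upper triangular X, w = 0
    -- once w k = 0 for t k ≤ m, and then ξ = w N₀ = 0.
    injective-II : ∀ m → InjectiveOn (∁ (atLeast r (suc m))) (∁ (atLeast t (suc m))) (A₀ K.ᵀ)
    injective-II m ξ ξ-supp A₀ᵀξ≈0 j = begin⟨ setoid ⟩
      ξ j                      ≈⟨ K.◁-identity ξ A₀N₀≈δ j ⟨
      (ξ K.◁ (A₀ K.⊛ N₀)) j    ≈⟨ K.◁-assoc ξ A₀ N₀ j ⟩
      (w K.◁ N₀) j             ≈⟨ K.sum-zero _ (λ k → trans (*-congʳ (w≈0 k)) (zeroˡ _)) ⟩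
      0#                       ∎
      where
      w : K.Vector d
      w = ξ K.◁ A₀
      wX≈0 : ∀ k → ((constant ∘ w) S.◁ X) k ≈[ p ∸ m ] 0ₚ
      wX≈0 k = ≈[]-trans (A₀-X (ℕP.m∸n≤m p m) ξ k) (D′C-supported m ξ ξ-supp k)
      small-or-zero : ∀ k → p ∸ t k < p ∸ m ⊎ w k ≈ 0#
      small-or-zero k with t k ℕ.≤? m
      ... | yes tₖ≤m = inj₂ (trans (K.◁-as-▷ ξ A₀ k) (A₀ᵀξ≈0 k (x∉p⇒x∈∁p (ℕP.<⇒≱ (s≤s tₖ≤m) ∘ ∈-atLeast⁻ t))))
      ... | no  tₖ≰m = inj₁ (ℕP.∸-monoʳ-< (ℕP.≰⇒> tₖ≰m) (t≤p k))
      w≈0 : ∀ k → w k ≈ 0#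
      w≈0 = row-pivot X-upper (λ k → p ∸ t k) X-unit (p ∸ m) w wX≈0 small-or-zero

    level-sets : ∀ s → ∣ atLeast t s ∣ ≡ ∣ atLeast r s ∣
    level-sets s = ℕP.≤-antisym (t≤r s) (rank-bound (injective-I s))
      where
      t≤r : ∀ s → ∣ atLeast t s ∣ ≤ ∣ atLeast r s ∣
      t≤r zero    = p⊆q⇒∣p∣≤∣q∣ {p = atLeast t 0} λ _ → ∈-atLeast⁺ r z≤n
      t≤r (suc m) = ∣∁p∣≤∣∁q∣⇒∣q∣≤∣p∣ (atLeast r (suc m)) (atLeast t (suc m)) (rank-bound (injective-II m))

lemma2p4 : {c ℓ : Level} (F : FiniteField c ℓ) → let open PowerSeries F in
    (p : ℕ) → IsCharacteristic p →
    (d : ℕ) → 1 ≤ d →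
    (M B A : Mat d) (cs : Fin d → PS) (t r : Fin d → ℕ) →
    UpperTriangularWithDiag M cs t → (∀ i → IsUnitₚ (cs i)) →
    IsGL B →
    (∀ i j → toℕ i ≤ toℕ j → r i ≤ r j) → (∀ i → r i ≤ p) →
    IsGL-u^p p A →
    M ≈ₘ ((B *ₘ diagU r) *ₘ A) →
    (∀ i → Σ (Fin d) λ j → t i ≡ r j) × (∀ j → Σ (Fin d) λ i → r j ≡ t i)
lemma2p4 F p _ d _ M B A cs t r M-shape cs-unit B-invertible _ r≤p A-invertible M≈BDA =
  values-transfer t r level-sets , values-transfer r t (≡.sym ∘ level-sets)
  where
  open LevelSets using (values-transfer)
  open Factorisation.Setting F p d M B A cs t r M-shape cs-unit B-invertible r≤p A-invertible M≈BDA
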